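{- Let $p$ be an odd prime, let $\theta$ be a generator of $\mathbb{F}_p^*$, and let $t \geq 1$ be an integer dividing $p-1$. Put $\mu = \theta^{(p-1)/t}$, $\Gamma = \mathbb{Z}_{(p-1)/t} \times \mathbb{F}_p$, and \[ S = \{ (m, \theta^m \mu^n) : m \in \mathbb{Z}_{(p-1)/t},\ 0 \leq n \leq t-1 \}, \] where $m$ is identified with its least nonnegative residue when computing $\theta^m$. Let $H_{p,t}$ be the graph with vertex set $\Gamma$ in which distinct vertices $(x,y),(a,b)$ are adjacent iff $(x,y)+(a,b)\in S$. Let $H_{p,t}^*$ be the graph obtained from $H_{p,t}$ by adding one new vertex adjacent to exactly those vertices of $H_{p,t}$ that have degree $p-2$ in $H_{p,t}$. Then $H_{p,t}^*$ contains no subgraph isomorphic to $K_{2,2t+1}$.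
   Context: $K_{2,2t+1}$ is the complete bipartite graph with parts of sizes $2$ and $2t+1$. -}

module Defs where

open import Data.Nat using (ℕ; zero; suc; _+_; _*_; _∸_; _^_; _<ᵇ_; _/_; _%_; NonZero)
open import Data.Nat.Properties using () renaming (_≟_ to _≟ℕ_)
open import Data.Fin using (Fin; toℕ)
open import Data.Fin.Properties using (any?) renaming (_≟_ to _≟F_)
open import Data.Product using (Σ; ∃; _×_; _,_)
open import Data.Product.Properties using (≡-dec)
open import Data.Sum using (_⊎_; inj₁; inj₂)
open import Data.Maybe using (Maybe; just; nothing)
open import Data.Empty using (⊥)
open import Data.Bool using (if_then_else_)
open import Data.List using (List; length; filter; cartesianProduct; allFin)
open import Relation.Nullary using (¬_; Dec; yes; no)
open import Relation.Nullary.Decidable using (_×-dec_; ¬?)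
open import Relation.Binary.PropositionalEquality using (_≡_; _≢_)
open import Function.Definitions using (Injective)

IsGenerator : (p : ℕ) .{{_ : NonZero p}} → ℕ → Set
IsGenerator p θ = (x : Fin p) → toℕ x ≢ 0 → ∃ λ k → (θ ^ k) % p ≡ toℕ x

ContainsK2 : {V : Set} → (V → V → Set) → ℕ → Set
ContainsK2 {V} Adj s =
  Σ (Fin 2 ⊎ Fin s → V) λ f →
    Injective _≡_ _≡_ f × ((i : Fin 2) (j : Fin s) → Adj (f (inj₁ i)) (f (inj₂ j)))

-- k reduced modulo d, assuming k < 2d (used for sums of two residues mod d)
red : ℕ → ℕ → ℕ
red d k = if k <ᵇ d then k else k ∸ d

module HGraph (p : ℕ) .{{_ : NonZero p}} (θ t : ℕ) .{{_ : NonZero t}} where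

  d : ℕ
  d = (p ∸ 1) / t

  μ : ℕ
  μ = θ ^ d

  Γ : Set
  Γ = Fin d × Fin p

  addΓ : Γ → Γ → ℕ × ℕ
  addΓ (x , y) (a , b) = red d (toℕ x + toℕ a) , (toℕ y + toℕ b) % p

  InS : ℕ × ℕ → Set
  InS (m , y) = Σ (Fin t) λ n → y ≡ (θ ^ m * μ ^ toℕ n) % p

  inS? : (z : ℕ × ℕ) → Dec (InS z)
  inS? (m , y) = any? λ n → y ≟ℕ ((θ ^ m * μ ^ toℕ n) % p)

  _≟Γ_ : (u v : Γ) → Dec (u ≡ v)
  _≟Γ_ = ≡-dec _≟F_ _≟F_

  Adj : Γ → Γ → Set
  Adj u v = u ≢ v × InS (addΓ u v)

  adj? : (u v : Γ) → Dec (Adj u v)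
  adj? u v = ¬? (u ≟Γ v) ×-dec inS? (addΓ u v)

  allΓ : List Γ
  allΓ = cartesianProduct (allFin d) (allFin p)

  degree : Γ → ℕ
  degree v = length (filter (adj? v) allΓ)

  Γ* : Set
  Γ* = Maybe Γ

  Adj* : Γ* → Γ* → Set
  Adj* (just u) (just v) = Adj u v
  Adj* (just u) nothing  = degree u ≡ p ∸ 2
  Adj* nothing  (just v) = degree v ≡ p ∸ 2
  Adj* nothing  nothing  = ⊥

-- Write p = N + 1, d = N / t and Γ = ℤ_d × 𝔽_p.  Since θ has order N, the set S is
-- {(e mod d, θ^e) : 0 ≤ e < N}, so every edge uv of H_{p,t} carries an exponent e with
-- u + v = (e, θ^e), and a vertex together with e determines its neighbour.
--
-- Write u = (u₁, u₂).  If v is a common neighbour of distinct u, w ∈ Γ, with exponents e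
-- and e', then δ = e' - e (mod N) satisfies δ ≡ w₁ - u₁ (mod d) and (θ^δ - 1) θ^e = w₂ - u₂,
-- where θ^δ ≠ 1.  So the quotient of δ by d, which takes t values, determines δ, then θ^e,
-- then v: u and w have at most t common neighbours in H_{p,t}, and at most t + 1 in H*_{p,t}.
--
-- A vertex v of degree p - 2 must satisfy v + v ∈ S, since the N elements of S give N
-- distinct vertices x with v + x ∈ S.  For a common neighbour v of the new vertex and
-- u ∈ Γ, with exponents e of u + v and e₀ of v + v, the shift δ = e₀ - 2e (mod N) is
-- again fixed modulo d, and c = θ^δ satisfies c θ^{2e} - 2θ^e = -2u₂.  A nondegenerate
-- quadratic takes each value at most twice, so each of the t quotients of δ by d belongs
-- to at most two such v, which gives at most 2t of them.
module Submission where

open import Defs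
open import Data.Bool using (T; true; false)
open import Data.Empty using (⊥)
open import Data.Fin as Fin using (Fin; toℕ; fromℕ<; join; splitAt)
open import Data.Fin.Properties using (toℕ-fromℕ<; toℕ<n)
import Data.Fin.Properties as FinP
open import Data.Integer as ℤ using (ℤ; +_; _-_; -_; _%ℕ_)
open import Data.Integer.DivMod using (n%ℕd<d; a≡a%ℕn+[a/ℕn]*n)
open import Data.Integer.Divisibility.Signed as ℤDiv using (divides; ∣ᵤ⇒∣; ∣⇒∣ᵤ)
import Data.Integer.Properties as ℤP
open import Data.Integer.Tactic.RingSolver using (solve-∀)
open import Data.List as List using (List; length)
open import Data.List.Membership.Propositional using (_∈_)
open import Data.List.Membership.Propositional.Properties using (∈-filter⁺; ∈-cartesianProduct⁺; ∈-allFin)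
open import Data.List.Relation.Unary.Any.Properties using (lookup-index)
open import Data.Maybe using (just; nothing)
open import Data.Nat as ℕ
  using (ℕ; zero; suc; NonZero; _≤_; _<_; _+_; _*_; _∸_; _%_; _/_; _^_; _<ᵇ_; z≤n; s≤s; >-nonZero; >-nonZero⁻¹)
import Data.Nat.DivMod as ℕD
open import Data.Nat.Divisibility as ℕDiv using (_∣_)
open import Data.Nat.Primality using (Prime; euclidsLemma; prime⇒nonZero; ¬prime[0]; ¬prime[1])
import Data.Nat.Properties as ℕP
open import Data.Product using (∃; ∃₂; _×_; _,_; proj₁; proj₂)
open import Data.Sum as Sum using (_⊎_; inj₁; inj₂; [_,_]′)
open import Data.Sum.Properties using (inj₁-injective; inj₂-injective)
open import Function using (_∘_; flip; case_of_)
open import Function.Definitions using (Injective)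
open import Relation.Binary.Bundles using (Setoid)
open import Relation.Binary.PropositionalEquality
import Relation.Binary.Reasoning.Setoid as SetoidReasoning
open import Relation.Nullary using (¬_; Dec; yes; no; contradiction)
open import Relation.Nullary.Decidable using (_×-dec_)

-- Congruences of integers

infix 4 _≡_mod_

record _≡_mod_ (a b : ℤ) (n : ℕ) : Set where
  constructor ≡mod
  field divides-difference : + n ℤDiv.∣ a - b

module _ {n : ℕ} where

  ≡mod-reflexive : ∀ {a b} → a ≡ b → a ≡ b mod n
  ≡mod-reflexive {a} refl = ≡mod (divides ℤ.0ℤ (ℤP.+-inverseʳ a))

  ≡mod-refl : ∀ {a} → a ≡ a mod n
  ≡mod-refl = ≡mod-reflexive refl

  ≡mod-sym : ∀ {a b} → a ≡ b mod n → b ≡ a mod n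
  ≡mod-sym {a} {b} (≡mod n∣a-b) = ≡mod (subst (+ n ℤDiv.∣_) (negate-difference a b) (ℤDiv.∣m⇒∣-m n∣a-b))
    where negate-difference : ∀ a b → - (a - b) ≡ b - a
          negate-difference = solve-∀

  ≡mod-trans : ∀ {a b c} → a ≡ b mod n → b ≡ c mod n → a ≡ c mod n
  ≡mod-trans {a} {b} {c} (≡mod n∣a-b) (≡mod n∣b-c) =
    ≡mod (subst (+ n ℤDiv.∣_) (telescope a b c) (ℤDiv.∣m∣n⇒∣m+n n∣a-b n∣b-c))
    where telescope : ∀ a b c → (a - b) ℤ.+ (b - c) ≡ a - c
          telescope = solve-∀

  +-cong-mod : ∀ {a b c d} → a ≡ b mod n → c ≡ d mod n → a ℤ.+ c ≡ b ℤ.+ d mod n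
  +-cong-mod {a} {b} {c} {d} (≡mod n∣a-b) (≡mod n∣c-d) =
    ≡mod (subst (+ n ℤDiv.∣_) (regroup a b c d) (ℤDiv.∣m∣n⇒∣m+n n∣a-b n∣c-d))
    where regroup : ∀ a b c d → (a - b) ℤ.+ (c - d) ≡ (a ℤ.+ c) - (b ℤ.+ d)
          regroup = solve-∀

  -‿cong-mod : ∀ {a b} → a ≡ b mod n → - a ≡ - b mod n
  -‿cong-mod {a} {b} (≡mod n∣a-b) = ≡mod (subst (+ n ℤDiv.∣_) (regroup a b) (ℤDiv.∣m⇒∣-m n∣a-b))
    where regroup : ∀ a b → - (a - b) ≡ - a - - b
          regroup = solve-∀

  *-cong-mod : ∀ {a b c d} → a ≡ b mod n → c ≡ d mod n → a ℤ.* c ≡ b ℤ.* d mod n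
  *-cong-mod {a} {b} {c} {d} (≡mod n∣a-b) (≡mod n∣c-d) =
    ≡mod (subst (+ n ℤDiv.∣_) (regroup a b c d)
      (ℤDiv.∣m∣n⇒∣m+n (ℤDiv.∣m⇒∣m*n c n∣a-b) (ℤDiv.∣m⇒∣m*n b n∣c-d)))
    where regroup : ∀ a b c d → (a - b) ℤ.* c ℤ.+ (c - d) ℤ.* b ≡ a ℤ.* c - b ℤ.* d
          regroup = solve-∀

-cong-mod : ∀ {n a b c d} → a ≡ b mod n → c ≡ d mod n → a - c ≡ b - d mod n
-cong-mod a≡b c≡d = +-cong-mod a≡b (-‿cong-mod c≡d)

≡mod-setoid : ℕ → Setoid _ _
≡mod-setoid n = record
  { Carrier = ℤ
  ; _≈_ = λ a b → a ≡ b mod n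
  ; isEquivalence = record { refl = ≡mod-refl ; sym = ≡mod-sym ; trans = ≡mod-trans }
  }

module ≡mod-Reasoning (n : ℕ) = SetoidReasoning (≡mod-setoid n)

%ℕ-≡mod : ∀ i n .{{_ : NonZero n}} → + (i %ℕ n) ≡ i mod n
%ℕ-≡mod i n = ≡mod (divides (- (i ℤ./ℕ n)) (begin
  + (i %ℕ n) - i                                  ≡⟨ cong (λ j → + (i %ℕ n) - j) (a≡a%ℕn+[a/ℕn]*n i n) ⟩
  + (i %ℕ n) - (+ (i %ℕ n) ℤ.+ i ℤ./ℕ n ℤ.* + n)  ≡⟨ cancel (+ (i %ℕ n)) (i ℤ./ℕ n) (+ n) ⟩
  - (i ℤ./ℕ n) ℤ.* + n                            ∎))
  where
  open ≡-Reasoning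
  cancel : ∀ r q n → r - (r ℤ.+ q ℤ.* n) ≡ - q ℤ.* n
  cancel = solve-∀

private
  ≡mod-injective-≥ : ∀ {n a b} → a < n → b ≤ a → + a ≡ + b mod n → a ≡ b
  ≡mod-injective-≥ {n} {a} {b} a<n b≤a (≡mod n∣a-b) = ℕP.≤-antisym (ℕP.m∸n≡0⇒m≤n a∸b≡0) b≤a
    where
    instance _ = >-nonZero (ℕP.≤-<-trans z≤n a<n)
    n∣a∸b : n ℕDiv.∣ a ∸ b
    n∣a∸b = ∣⇒∣ᵤ (subst (+ n ℤDiv.∣_) (trans (ℤP.m-n≡m⊖n a b) (ℤP.⊖-≥ b≤a)) n∣a-b)
    a∸b≡0 : a ∸ b ≡ 0
    a∸b≡0 = trans (sym (ℕD.m<n⇒m%n≡m (ℕP.≤-<-trans (ℕP.m∸n≤m a b) a<n))) (ℕDiv.n∣m⇒m%n≡0 _ n n∣a∸b)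

≡mod-injective : ∀ {n a b} → a < n → b < n → + a ≡ + b mod n → a ≡ b
≡mod-injective {a = a} {b} a<n b<n a≡b with ℕP.≤-total b a
... | inj₁ b≤a = ≡mod-injective-≥ a<n b≤a a≡b
... | inj₂ a≤b = sym (≡mod-injective-≥ b<n a≤b (≡mod-sym a≡b))

≡mod⇒%ℕ≡ : ∀ {n i j} .{{_ : NonZero n}} → i ≡ j mod n → i %ℕ n ≡ j %ℕ n
≡mod⇒%ℕ≡ {n} {i} {j} i≡j = ≡mod-injective (n%ℕd<d i n) (n%ℕd<d j n)
  (≡mod-trans (%ℕ-≡mod i n) (≡mod-trans i≡j (≡mod-sym (%ℕ-≡mod j n))))

%ℕ≡⇒≡mod : ∀ {n i j} .{{_ : NonZero n}} → i %ℕ n ≡ j %ℕ n → i ≡ j mod n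
%ℕ≡⇒≡mod {n} {i} {j} eq =
  ≡mod-trans (≡mod-sym (%ℕ-≡mod i n)) (≡mod-trans (≡mod-reflexive (cong +_ eq)) (%ℕ-≡mod j n))

≡mod-weaken : ∀ {m n a b} → m ℕDiv.∣ n → a ≡ b mod n → a ≡ b mod m
≡mod-weaken m∣n (≡mod n∣a-b) = ≡mod (ℤDiv.∣-trans (∣ᵤ⇒∣ m∣n) n∣a-b)

+-cancelˡ-mod : ∀ {n} c {a b} → c ℤ.+ a ≡ c ℤ.+ b mod n → a ≡ b mod n
+-cancelˡ-mod {n} c {a} {b} (≡mod n∣difference) = ≡mod (subst (+ n ℤDiv.∣_) (cancel c a b) n∣difference)
  where cancel : ∀ c a b → (c ℤ.+ a) - (c ℤ.+ b) ≡ a - b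
        cancel = solve-∀

≡0-mod⇒∣ : ∀ {n a} → a ≡ ℤ.0ℤ mod n → + n ℤDiv.∣ a
≡0-mod⇒∣ {n} {a} (≡mod n∣a-0) = subst (+ n ℤDiv.∣_) (ℤP.+-identityʳ a) n∣a-0

∣⇒≡0-mod : ∀ {n a} → + n ℤDiv.∣ a → a ≡ ℤ.0ℤ mod n
∣⇒≡0-mod {n} {a} n∣a = ≡mod (subst (+ n ℤDiv.∣_) (sym (ℤP.+-identityʳ a)) n∣a)

≡mod⇒-≡0 : ∀ {n a b} → a ≡ b mod n → a - b ≡ ℤ.0ℤ mod n
≡mod⇒-≡0 (≡mod n∣a-b) = ∣⇒≡0-mod n∣a-b

-≡0⇒≡mod : ∀ {n a b} → a - b ≡ ℤ.0ℤ mod n → a ≡ b mod n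
-≡0⇒≡mod a-b≡0 = ≡mod (≡0-mod⇒∣ a-b≡0)

quadratic : ℤ → ℤ → ℤ → ℤ
quadratic c b x = c ℤ.* x ℤ.* x ℤ.+ b ℤ.* x

private
  *-distribˡ-difference : ∀ c a b → c ℤ.* (a - b) ≡ c ℤ.* a - c ℤ.* b
  *-distribˡ-difference = solve-∀

  quadratic-difference : ∀ c b x y → (x - y) ℤ.* (c ℤ.* (x ℤ.+ y) - - b)
                                     ≡ (c ℤ.* x ℤ.* x ℤ.+ b ℤ.* x) - (c ℤ.* y ℤ.* y ℤ.+ b ℤ.* y)
  quadratic-difference = solve-∀

  +-cancelʳ-difference : ∀ a b c → (a ℤ.+ c) - (b ℤ.+ c) ≡ a - b
  +-cancelʳ-difference = solve-∀

  doubled-sum-difference : ∀ a b → (b ℤ.+ b) - ((a ℤ.+ b) ℤ.+ (a ℤ.+ b)) ≡ - (a ℤ.+ a)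
  doubled-sum-difference = solve-∀

module _ {p} (p-prime : Prime p) where

  a*b≡0-mod⇒a≡0∨b≡0 : ∀ a b → a ℤ.* b ≡ ℤ.0ℤ mod p → a ≡ ℤ.0ℤ mod p ⊎ b ≡ ℤ.0ℤ mod p
  a*b≡0-mod⇒a≡0∨b≡0 a b ab≡0 =
    Sum.map (∣⇒≡0-mod ∘ ∣ᵤ⇒∣) (∣⇒≡0-mod ∘ ∣ᵤ⇒∣)
      (euclidsLemma ℤ.∣ a ∣ ℤ.∣ b ∣ p-prime (subst (p ℕDiv.∣_) (ℤP.abs-* a b) (∣⇒∣ᵤ (≡0-mod⇒∣ ab≡0))))

  *-cancelˡ-mod : ∀ {c a b} → ¬ c ≡ ℤ.0ℤ mod p → c ℤ.* a ≡ c ℤ.* b mod p → a ≡ b mod p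
  *-cancelˡ-mod {c} {a} {b} c≢0 ca≡cb =
    [ flip contradiction c≢0 , -≡0⇒≡mod ]′
      (a*b≡0-mod⇒a≡0∨b≡0 c (a - b) (≡mod-trans (≡mod-reflexive (*-distribˡ-difference c a b)) (≡mod⇒-≡0 ca≡cb)))

  quadratic-≤2-to-1 : ∀ {c b x₁ x₂ x₃} → ¬ c ≡ ℤ.0ℤ mod p →
    quadratic c b x₁ ≡ quadratic c b x₂ mod p → quadratic c b x₂ ≡ quadratic c b x₃ mod p →
    ¬ x₁ ≡ x₂ mod p → ¬ x₂ ≡ x₃ mod p → x₁ ≡ x₃ mod p
  quadratic-≤2-to-1 {c} {b} {x₁} {x₂} {x₃} c≢0 f₁≡f₂ f₂≡f₃ x₁≢x₂ x₂≢x₃ =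
    +-cancelˡ-mod x₂ (*-cancelˡ-mod c≢0 (begin
      c ℤ.* (x₂ ℤ.+ x₁)   ≡⟨ cong (c ℤ.*_) (ℤP.+-comm x₂ x₁) ⟩
      c ℤ.* (x₁ ℤ.+ x₂)   ≈⟨ collision f₁≡f₂ x₁≢x₂ ⟩
      - b                 ≈⟨ collision f₂≡f₃ x₂≢x₃ ⟨
      c ℤ.* (x₂ ℤ.+ x₃)   ∎))
    where
    open ≡mod-Reasoning p
    collision : ∀ {x y} → quadratic c b x ≡ quadratic c b y mod p →
                ¬ x ≡ y mod p → c ℤ.* (x ℤ.+ y) ≡ - b mod p
    collision {x} {y} fx≡fy x≢y =
      [ flip contradiction x≢y ∘ -≡0⇒≡mod , -≡0⇒≡mod ]′
        (a*b≡0-mod⇒a≡0∨b≡0 (x - y) (c ℤ.* (x ℤ.+ y) - - b)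
          (≡mod-trans (≡mod-reflexive (quadratic-difference c b x y)) (≡mod⇒-≡0 fx≡fy)))

-- Remainders

red≡% : ∀ d .{{_ : NonZero d}} k → k < d + d → red d k ≡ k % d
red≡% d k k<d+d with k <ᵇ d in k<ᵇd
... | true  = sym (ℕD.m<n⇒m%n≡m (ℕP.<ᵇ⇒< k d (subst T (sym k<ᵇd) _)))
... | false = trans (sym (ℕD.m<n⇒m%n≡m k∸d<d)) (ℕD.m≤n⇒[n∸m]%m≡n%m d≤k)
  where
  d≤k : d ≤ k
  d≤k = ℕP.≮⇒≥ λ k<d → subst T k<ᵇd (ℕP.<⇒<ᵇ k<d)
  k∸d<d : k ∸ d < d
  k∸d<d = ℕP.+-cancelʳ-< _ _ _ (subst (_< d + d) (sym (ℕP.m∸n+n≡m d≤k)) k<d+d)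

%-/-injective : ∀ {m n d} .{{_ : NonZero d}} → m % d ≡ n % d → m / d ≡ n / d → m ≡ n
%-/-injective {m} {n} {d} m%d≡n%d m/d≡n/d = begin
  m                      ≡⟨ ℕD.m≡m%n+[m/n]*n m d ⟩
  m % d + m / d * d  ≡⟨ cong₂ (λ r q → r + q * d) m%d≡n%d m/d≡n/d ⟩
  n % d + n / d * d  ≡⟨ ℕD.m≡m%n+[m/n]*n n d ⟨
  n                      ∎
  where open ≡-Reasoning

reduce : ∀ {n} .{{_ : NonZero n}} → ℤ → Fin n
reduce {n} i = fromℕ< (n%ℕd<d i n)

reduce-≡mod : ∀ {n} .{{_ : NonZero n}} i → + toℕ (reduce {n} i) ≡ i mod n
reduce-≡mod {n} i = ≡mod-trans (≡mod-reflexive (cong +_ (toℕ-fromℕ< (n%ℕd<d i n)))) (%ℕ-≡mod i n)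

reduce-injective : ∀ {n} .{{_ : NonZero n}} i j → reduce {n} i ≡ reduce j → i ≡ j mod n
reduce-injective {n} i j i≡j = ≡mod-trans (≡mod-sym (reduce-≡mod i))
  (≡mod-trans (≡mod-reflexive (cong (+_ ∘ toℕ) i≡j)) (reduce-≡mod j))

+-reduce-difference : ∀ {n} .{{_ : NonZero n}} a i → a ℤ.+ + toℕ (reduce {n} (i - a)) ≡ i mod n
+-reduce-difference {n} a i = begin
  a ℤ.+ + toℕ (reduce {n} (i - a))   ≈⟨ +-cong-mod (≡mod-refl {a = a}) (reduce-≡mod (i - a)) ⟩
  a ℤ.+ (i - a)                      ≡⟨ cancel a i ⟩
  i                                  ∎
  where
  open ≡mod-Reasoning n
  cancel : ∀ a i → a ℤ.+ (i - a) ≡ i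
  cancel = solve-∀

-- Counting

injective⇒≤-length : ∀ {A : Set} {n} {xs : List A} {f : Fin n → A} →
                     Injective _≡_ _≡_ f → (∀ i → f i ∈ xs) → n ≤ length xs
injective⇒≤-length {xs = xs} {f} f-injective f∈xs = FinP.injective⇒≤ λ {i} {j} eq →
  f-injective (trans (lookup-index (f∈xs i)) (trans (cong (List.lookup xs) eq) (sym (lookup-index (f∈xs j)))))

module _ {m n} (f : Fin n → Fin m) where

  private
    Repeated : Fin n → Set
    Repeated j = ∃ λ i → i Fin.< j × f i ≡ f j

    repeated? : ∀ j → Dec (Repeated j)
    repeated? j = FinP.any? λ i → (i FinP.<? j) ×-dec (f i FinP.≟ f j)

    tag : ∀ {j} → Dec (Repeated j) → Fin m ⊎ Fin m
    tag {j} (yes _) = inj₂ (f j)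
    tag {j} (no _)  = inj₁ (f j)

  ThreeEqualValues : Set
  ThreeEqualValues = ∃₂ λ i j → ∃ λ k → i Fin.< j × j Fin.< k × f i ≡ f j × f j ≡ f k

  private
    repetition-of-tags : ∀ {j k} → j Fin.< k → (rj : Dec (Repeated j)) (rk : Dec (Repeated k)) →
                         tag rj ≡ tag rk → ThreeEqualValues
    repetition-of-tags {j} {k} j<k (yes (i , i<j , fi≡fj)) (yes _) eq =
      i , j , k , i<j , j<k , fi≡fj , inj₂-injective eq
    repetition-of-tags {j} j<k (no _) (no k-fresh) eq = contradiction (j , j<k , inj₁-injective eq) k-fresh
    repetition-of-tags _ (yes _) (no _) ()
    repetition-of-tags _ (no _) (yes _) ()

  -- Tag each argument by whether its value already occurs at a smaller one.  Two of the n > 2m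
  -- tagged values agree, and the later of them cannot be fresh, so both repeat earlier values.
  pigeonhole₃ : m + m < n → ThreeEqualValues
  pigeonhole₃ m+m<n with FinP.pigeonhole m+m<n (λ j → join m m (tag (repeated? j)))
  ... | j , k , j<k , tags≡ = repetition-of-tags j<k (repeated? j) (repeated? k)
          (trans (sym (FinP.splitAt-join m m _)) (trans (cong (splitAt m) tags≡) (FinP.splitAt-join m m _)))

-- Powers of a primitive root

module PrimitiveRoot {N : ℕ} (p-prime : Prime (suc N)) (2≤N : 2 ≤ N)
                     {θ : ℕ} (θ-generates : IsGenerator (suc N) θ) where

  p : ℕ
  p = suc N

  0<N : 0 < N
  0<N = ℕP.≤-trans (s≤s z≤n) 2≤N

  instance
    N-nonZero : NonZero N
    N-nonZero = >-nonZero 0<N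

  open ≡mod-Reasoning p

  infix 8 θ^_
  θ^_ : ℕ → ℤ
  θ^ k = + (θ ^ k)

  θ^-+ : ∀ m n → θ^ (m + n) ≡ θ^ m ℤ.* θ^ n
  θ^-+ m n = trans (cong +_ (ℕP.^-distribˡ-+-* θ m n)) (ℤP.pos-* (θ ^ m) (θ ^ n))

  discrete-log : ∀ {y} → 0 < y → y < p → ∃ λ k → θ^ k ≡ + y mod p
  discrete-log {y} 0<y y<p with θ-generates (fromℕ< y<p) (ℕP.<⇒≢ 0<y ∘ sym ∘ trans (sym (toℕ-fromℕ< y<p)))
  ... | k , θ^k%p≡y = k , (begin
    θ^ k              ≈⟨ %ℕ-≡mod (θ^ k) p ⟨
    + ((θ ^ k) % p)   ≡⟨ cong +_ (trans θ^k%p≡y (toℕ-fromℕ< y<p)) ⟩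
    + y               ∎)

  -- This is where p ≠ 2 enters: the powers of a multiple of p are only 1 and 0, never 2.
  θ-nonzero : ¬ + θ ≡ ℤ.0ℤ mod p
  θ-nonzero θ≡0 with discrete-log {2} (s≤s z≤n) (s≤s 2≤N)
  ... | zero , 1≡2 = contradiction (≡mod-injective (s≤s 0<N) (s≤s 2≤N) 1≡2) λ ()
  ... | suc k , θ^k≡2 = contradiction (≡mod-injective (s≤s z≤n) (s≤s 2≤N) (begin
    + 0                  ≡⟨ ℤP.*-zeroˡ (θ^ k) ⟨
    ℤ.0ℤ ℤ.* θ^ k        ≈⟨ *-cong-mod θ≡0 (≡mod-refl {a = θ^ k}) ⟨
    + θ ℤ.* θ^ k         ≡⟨ ℤP.pos-* θ (θ ^ k) ⟨
    θ^ suc k             ≈⟨ θ^k≡2 ⟩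
    + 2                  ∎)) λ ()

  θ^-nonzero : ∀ k → ¬ θ^ k ≡ ℤ.0ℤ mod p
  θ^-nonzero zero 1≡0 = contradiction (≡mod-injective (s≤s 0<N) (s≤s z≤n) 1≡0) λ ()
  θ^-nonzero (suc k) θ^sk≡0 = [ θ-nonzero , θ^-nonzero k ]′
    (a*b≡0-mod⇒a≡0∨b≡0 p-prime (+ θ) (θ^ k) (≡mod-trans (≡mod-reflexive (sym (ℤP.pos-* θ (θ ^ k)))) θ^sk≡0))

  θ^-≡⇒θ^-∸≡1 : ∀ {i j} → i ≤ j → θ^ i ≡ θ^ j mod p → θ^ (j ∸ i) ≡ + 1 mod p
  θ^-≡⇒θ^-∸≡1 {i} {j} i≤j θ^i≡θ^j = ≡mod-sym (*-cancelˡ-mod p-prime (θ^-nonzero i) (begin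
    θ^ i ℤ.* + 1         ≡⟨ ℤP.*-identityʳ (θ^ i) ⟩
    θ^ i                 ≈⟨ θ^i≡θ^j ⟩
    θ^ j                 ≡⟨ cong θ^_ (ℕP.m+[n∸m]≡n i≤j) ⟨
    θ^ (i + (j ∸ i))     ≡⟨ θ^-+ i (j ∸ i) ⟩
    θ^ i ℤ.* θ^ (j ∸ i)  ∎))

  module _ {r} (θ^r≡1 : θ^ r ≡ + 1 mod p) where

    θ^-multiple-of-period : ∀ q → θ^ (q * r) ≡ + 1 mod p
    θ^-multiple-of-period zero    = ≡mod-refl
    θ^-multiple-of-period (suc q) = begin
      θ^ (r + q * r)         ≡⟨ θ^-+ r (q * r) ⟩
      θ^ r ℤ.* θ^ (q * r)    ≈⟨ *-cong-mod θ^r≡1 (θ^-multiple-of-period q) ⟩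
      + 1                    ∎

    θ^-%-period : .{{_ : NonZero r}} → ∀ k → θ^ (k % r) ≡ θ^ k mod p
    θ^-%-period k = begin
      θ^ (k % r)                      ≡⟨ ℤP.*-identityʳ (θ^ (k % r)) ⟨
      θ^ (k % r) ℤ.* + 1              ≈⟨ *-cong-mod (≡mod-refl {a = θ^ (k % r)}) (θ^-multiple-of-period (k / r)) ⟨
      θ^ (k % r) ℤ.* θ^ (k / r * r)   ≡⟨ θ^-+ (k % r) (k / r * r) ⟨
      θ^ (k % r + k / r * r)          ≡⟨ cong θ^_ (ℕD.m≡m%n+[m/n]*n k r) ⟨
      θ^ k                            ∎

    θ^-cong-period : .{{_ : NonZero r}} → ∀ {a b} → + a ≡ + b mod r → θ^ a ≡ θ^ b mod p
    θ^-cong-period {a} {b} a≡b = begin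
      θ^ a         ≈⟨ θ^-%-period a ⟨
      θ^ (a % r)   ≡⟨ cong θ^_ (≡mod⇒%ℕ≡ a≡b) ⟩
      θ^ (b % r)   ≈⟨ θ^-%-period b ⟩
      θ^ b         ∎

    -- Reducing discrete logarithms modulo r maps the N nonzero residues injectively into Fin r.
    order-≥ : 0 < r → N ≤ r
    order-≥ 0<r = FinP.injective⇒≤ {f = λ x → reduce {r} (+ log x)} λ {x} {y} logs≡ →
      FinP.toℕ-injective (ℕP.suc-injective (≡mod-injective (s≤s (toℕ<n x)) (s≤s (toℕ<n y)) (begin
        + suc (toℕ x)   ≈⟨ θ^-log x ⟨
        θ^ log x        ≈⟨ θ^-cong-period (reduce-injective (+ log x) (+ log y) logs≡) ⟩
        θ^ log y        ≈⟨ θ^-log y ⟩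
        + suc (toℕ y)   ∎)))
      where
      instance _ = >-nonZero 0<r
      log : Fin N → ℕ
      log x = proj₁ (discrete-log {suc (toℕ x)} (s≤s z≤n) (s≤s (toℕ<n x)))
      θ^-log : ∀ x → θ^ log x ≡ + suc (toℕ x) mod p
      θ^-log x = proj₂ (discrete-log {suc (toℕ x)} (s≤s z≤n) (s≤s (toℕ<n x)))

  private
    residue≢0 : ∀ i → Fin.zero ≢ reduce {p} (θ^ i)
    residue≢0 i 0≡residue =
      θ^-nonzero i (≡mod-sym (≡mod-trans (≡mod-reflexive (cong (+_ ∘ toℕ) 0≡residue)) (reduce-≡mod (θ^ i))))

  θ^-has-period : ∃ λ r → 0 < r × r ≤ N × θ^ r ≡ + 1 mod p
  θ^-has-period =
    let i , j , i<j , punchOuts≡ = FinP.pigeonhole (ℕP.n<1+n N) (λ i → Fin.punchOut (residue≢0 (toℕ i))) in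
    toℕ j ∸ toℕ i , ℕP.m<n⇒0<n∸m i<j , ℕP.≤-trans (ℕP.m∸n≤m (toℕ j) (toℕ i)) (ℕP.≤-pred (toℕ<n j)) ,
    θ^-≡⇒θ^-∸≡1 (ℕP.<⇒≤ i<j) (reduce-injective (θ^ toℕ i) (θ^ toℕ j)
      (FinP.punchOut-injective (residue≢0 (toℕ i)) (residue≢0 (toℕ j)) punchOuts≡))

  fermat : θ^ N ≡ + 1 mod p
  fermat =
    let r , 0<r , r≤N , θ^r≡1 = θ^-has-period in
    subst (λ r → θ^ r ≡ + 1 mod p) (ℕP.≤-antisym r≤N (order-≥ θ^r≡1 0<r)) θ^r≡1

  θ^-cong : ∀ {a b} → + a ≡ + b mod N → θ^ a ≡ θ^ b mod p
  θ^-cong = θ^-cong-period fermat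

  private
    θ^-injective-≤ : ∀ {a b} → a ≤ b → b < N → θ^ a ≡ θ^ b mod p → a ≡ b
    θ^-injective-≤ {a} {b} a≤b b<N θ^a≡θ^b with b ∸ a in b∸a≡
    ... | zero  = ℕP.≤-antisym a≤b (ℕP.m∸n≡0⇒m≤n b∸a≡)
    ... | suc r = contradiction (order-≥ θ^sr≡1 (s≤s z≤n))
                    (ℕP.<⇒≱ (ℕP.≤-<-trans (subst (_≤ b) b∸a≡ (ℕP.m∸n≤m b a)) b<N))
      where
      θ^sr≡1 : θ^ suc r ≡ + 1 mod p
      θ^sr≡1 = subst (λ e → θ^ e ≡ + 1 mod p) b∸a≡ (θ^-≡⇒θ^-∸≡1 a≤b θ^a≡θ^b)

  θ^-injective : ∀ {a b} → a < N → b < N → θ^ a ≡ θ^ b mod p → a ≡ b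
  θ^-injective {a} {b} a<N b<N θ^a≡θ^b with ℕP.≤-total a b
  ... | inj₁ a≤b = θ^-injective-≤ a≤b b<N θ^a≡θ^b
  ... | inj₂ b≤a = sym (θ^-injective-≤ b≤a a<N (≡mod-sym θ^a≡θ^b))

-- The graph H*_{p,t}

module Construction {N : ℕ} (p-prime : Prime (suc N)) (2≤N : 2 ≤ N)
                    {θ : ℕ} (θ-generates : IsGenerator (suc N) θ)
                    {t : ℕ} .{{_ : NonZero t}} (t∣N : t ℕDiv.∣ N) where

  open PrimitiveRoot p-prime 2≤N θ-generates
  open HGraph p θ t

  d*t≡N : d * t ≡ N
  d*t≡N = ℕD.m/n*n≡m t∣N

  N≡t*d : N ≡ t * d
  N≡t*d = sym (trans (ℕP.*-comm t d) d*t≡N)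

  d∣N : d ℕDiv.∣ N
  d∣N = ℕDiv.divides t (trans (sym d*t≡N) (ℕP.*-comm d t))

  instance
    d-nonZero : NonZero d
    d-nonZero = ℕ.≢-nonZero λ d≡0 → ℕ.≢-nonZero⁻¹ N (trans (sym d*t≡N) (cong (_* t) d≡0))

  θ^-split : ∀ m n → θ ^ (m + n * d) ≡ θ ^ m * μ ^ n
  θ^-split m n = begin
    θ ^ (m + n * d)        ≡⟨ ℕP.^-distribˡ-+-* θ m (n * d) ⟩
    θ ^ m * θ ^ (n * d)    ≡⟨ cong (λ k → θ ^ m * θ ^ k) (ℕP.*-comm n d) ⟩
    θ ^ m * θ ^ (d * n)    ≡⟨ cong (θ ^ m *_) (ℕP.^-*-assoc θ d n) ⟨
    θ ^ m * μ ^ n            ∎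
    where open ≡-Reasoning

  exponent-∈S : ∀ {e} → e < N → InS (e % d , θ ^ e % p)
  exponent-∈S {e} e<N = fromℕ< e/d<t , cong (_% p) (begin
    θ ^ e                                      ≡⟨ cong (θ ^_) (ℕD.m≡m%n+[m/n]*n e d) ⟩
    θ ^ (e % d + e / d * d)                ≡⟨ θ^-split (e % d) (e / d) ⟩
    θ ^ (e % d) * μ ^ (e / d)                ≡⟨ cong (λ n → θ ^ (e % d) * μ ^ n) (toℕ-fromℕ< e/d<t) ⟨
    θ ^ (e % d) * μ ^ toℕ (fromℕ< e/d<t)     ∎)
    where
    open ≡-Reasoning
    e/d<t : e / d < t
    e/d<t = ℕD.m<n*o⇒m/o<n (subst (e <_) N≡t*d e<N)

  coord₁ coord₂ : Γ → ℤ
  coord₁ (x , _) = + toℕ x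
  coord₂ (_ , y) = + toℕ y

  -- The element (m, θ^m μ^n) of S is (e mod d, θ^e) for e = m + n d < N.
  record SumExponent (u v : Γ) : Set where
    field
      exponent   : ℕ
      exponent<N : exponent < N
      coord₁-sum : + exponent ≡ coord₁ u ℤ.+ coord₁ v mod d
      coord₂-sum : θ^ exponent ≡ coord₂ u ℤ.+ coord₂ v mod p

  open SumExponent

  ∈S⇒SumExponent : ∀ {u v} → InS (addΓ u v) → SumExponent u v
  ∈S⇒SumExponent {a , b} {x , z} (n , b+z≡θ^mμ^n) = record
    { exponent   = e
    ; exponent<N = subst (e <_) (sym N≡t*d)
                     (ℕP.≤-trans (ℕP.+-monoˡ-< (toℕ n * d) m<d) (ℕP.*-monoˡ-≤ d (toℕ<n n)))
    ; coord₁-sum = %ℕ≡⇒≡mod (trans (ℕD.[m+kn]%n≡m%n m (toℕ n) d)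
                     (trans (cong (_% d) m≡) (ℕD.m%n%n≡m%n (toℕ a + toℕ x) d)))
    ; coord₂-sum = %ℕ≡⇒≡mod (trans (cong (_% p) (θ^-split m (toℕ n))) (sym b+z≡θ^mμ^n))
    }
    where
    m = red d (toℕ a + toℕ x)
    e = m + toℕ n * d
    m≡ : m ≡ (toℕ a + toℕ x) % d
    m≡ = red≡% d _ (ℕP.+-mono-< (toℕ<n a) (toℕ<n x))
    m<d : m < d
    m<d = subst (_< d) (sym m≡) (ℕD.m%n<n _ d)

  coords-injective : ∀ {u v} → coord₁ u ≡ coord₁ v mod d → coord₂ u ≡ coord₂ v mod p → u ≡ v
  coords-injective {x , y} {x' , y'} x≡x' y≡y' =
    cong₂ _,_ (FinP.toℕ-injective (≡mod-injective (toℕ<n x) (toℕ<n x') x≡x'))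
              (FinP.toℕ-injective (≡mod-injective (toℕ<n y) (toℕ<n y') y≡y'))

  SumExponent-unique : ∀ {u v v'} (s : SumExponent u v) (s' : SumExponent u v') →
                       θ^ exponent s ≡ θ^ exponent s' mod p → v ≡ v'
  SumExponent-unique {u} {v} {v'} s s' θ^e≡θ^e' =
    coords-injective (+-cancelˡ-mod (coord₁ u) u₁+v₁≡u₁+v'₁) (+-cancelˡ-mod (coord₂ u) u₂+v₂≡u₂+v'₂)
    where
    u₁+v₁≡u₁+v'₁ : coord₁ u ℤ.+ coord₁ v ≡ coord₁ u ℤ.+ coord₁ v' mod d
    u₁+v₁≡u₁+v'₁ = begin
      coord₁ u ℤ.+ coord₁ v     ≈⟨ coord₁-sum s ⟨
      + exponent s              ≡⟨ cong +_ (θ^-injective (exponent<N s) (exponent<N s') θ^e≡θ^e') ⟩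
      + exponent s'             ≈⟨ coord₁-sum s' ⟩
      coord₁ u ℤ.+ coord₁ v'    ∎
      where open ≡mod-Reasoning d
    u₂+v₂≡u₂+v'₂ : coord₂ u ℤ.+ coord₂ v ≡ coord₂ u ℤ.+ coord₂ v' mod p
    u₂+v₂≡u₂+v'₂ = begin
      coord₂ u ℤ.+ coord₂ v     ≈⟨ coord₂-sum s ⟨
      θ^ exponent s             ≈⟨ θ^e≡θ^e' ⟩
      θ^ exponent s'            ≈⟨ coord₂-sum s' ⟩
      coord₂ u ℤ.+ coord₂ v'    ∎
      where open ≡mod-Reasoning p

  self-sum∉S⇒N≤degree : ∀ v → ¬ InS (addΓ v v) → N ≤ degree v
  self-sum∉S⇒N≤degree v@(a , b) v+v∉S = injective⇒≤-length partner-injective λ e →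
    ∈-filter⁺ (adj? v) (∈-cartesianProduct⁺ (∈-allFin _) (∈-allFin _)) (partner-adjacent e)
    where
    partner : Fin N → Γ
    partner e = reduce (+ toℕ e - coord₁ v) , reduce (θ^ toℕ e - coord₂ v)

    v+partner : ∀ e → addΓ v (partner e) ≡ (toℕ e % d , θ ^ toℕ e % p)
    v+partner e = cong₂ _,_
      (trans (red≡% d _ (ℕP.+-mono-< (toℕ<n a) (toℕ<n (proj₁ (partner e)))))
             (≡mod⇒%ℕ≡ (+-reduce-difference {d} (coord₁ v) (+ toℕ e))))
      (≡mod⇒%ℕ≡ (+-reduce-difference {p} (coord₂ v) (θ^ toℕ e)))

    partner-adjacent : ∀ e → Adj v (partner e)
    partner-adjacent e =
      (λ v≡partner → v+v∉S (subst (λ w → InS (addΓ v w)) (sym v≡partner) v+partner∈S)) , v+partner∈S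
      where v+partner∈S = subst InS (sym (v+partner e)) (exponent-∈S (toℕ<n e))

    partner-injective : Injective _≡_ _≡_ partner
    partner-injective {e} {e'} eq = FinP.toℕ-injective (θ^-injective (toℕ<n e) (toℕ<n e') (%ℕ≡⇒≡mod
      (trans (sym (cong proj₂ (v+partner e))) (trans (cong (proj₂ ∘ addΓ v) eq) (cong proj₂ (v+partner e'))))))

  degree≡p∸2⇒self-sum∈S : ∀ v → degree v ≡ p ∸ 2 → InS (addΓ v v)
  degree≡p∸2⇒self-sum∈S v degree≡N∸1 with inS? (addΓ v v)
  ... | yes v+v∈S = v+v∈S
  ... | no  v+v∉S = contradiction (subst (N ≤_) degree≡N∸1 (self-sum∉S⇒N≤degree v v+v∉S))
                                  (ℕP.<⇒≱ (ℕP.∸-monoʳ-< {o = 0} (s≤s z≤n) 0<N))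

  shift : ℕ → ℕ → ℕ
  shift e e' = (+ e' - + e) %ℕ N

  shift<N : ∀ e e' → shift e e' < N
  shift<N e e' = n%ℕd<d (+ e' - + e) N

  shift-≡mod : ∀ e e' → + shift e e' ≡ + e' - + e mod N
  shift-≡mod e e' = %ℕ-≡mod (+ e' - + e) N

  shift-+ : ∀ e e' → + shift e e' ℤ.+ + e ≡ + e' mod N
  shift-+ e e' = begin
    + shift e e' ℤ.+ + e   ≈⟨ +-cong-mod (shift-≡mod e e') (≡mod-refl {a = + e}) ⟩
    (+ e' - + e) ℤ.+ + e   ≡⟨ cancel (+ e') (+ e) ⟩
    + e'                   ∎
    where
    open ≡mod-Reasoning N
    cancel : ∀ a b → (a - b) ℤ.+ b ≡ a
    cancel = solve-∀

  θ^-shift : ∀ e e' → θ^ shift e e' ℤ.* θ^ e ≡ θ^ e' mod p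
  θ^-shift e e' = ≡mod-trans (≡mod-reflexive (sym (θ^-+ (shift e e') e))) (θ^-cong (shift-+ e e'))

  shift-quotient : ℕ → ℕ → Fin t
  shift-quotient e e' = fromℕ< (ℕD.m<n*o⇒m/o<n (subst (shift e e' <_) N≡t*d (shift<N e e')))

  shift-quotient-injective : ∀ e₁ e₁' e₂ e₂' → + shift e₁ e₁' ≡ + shift e₂ e₂' mod d →
                             shift-quotient e₁ e₁' ≡ shift-quotient e₂ e₂' → shift e₁ e₁' ≡ shift e₂ e₂'
  shift-quotient-injective e₁ e₁' e₂ e₂' δ₁≡δ₂ q₁≡q₂ = %-/-injective {d = d} (≡mod⇒%ℕ≡ δ₁≡δ₂)
    (FinP.fromℕ<-injective (shift e₁ e₁' / d) (shift e₂ e₂' / d) _ _ q₁≡q₂)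

  module TwoVertices {u w : Γ} (u≢w : u ≢ w) where

    private
      u₁ = coord₁ u
      u₂ = coord₂ u
      w₁ = coord₁ w
      w₂ = coord₂ w

    module _ {v} (s : SumExponent u v) (s' : SumExponent w v) where

      private
        v₁ = coord₁ v
        v₂ = coord₂ v
        e  = exponent s
        e' = exponent s'
        δ  = shift e e'

      pair-shift-≡ : + δ ≡ w₁ - u₁ mod d
      pair-shift-≡ = begin
        + δ                        ≈⟨ ≡mod-weaken d∣N (shift-≡mod e e') ⟩
        + e' - + e                 ≈⟨ -cong-mod (coord₁-sum s') (coord₁-sum s) ⟩
        (w₁ ℤ.+ v₁) - (u₁ ℤ.+ v₁)  ≡⟨ +-cancelʳ-difference w₁ u₁ v₁ ⟩
        w₁ - u₁                    ∎
        where open ≡mod-Reasoning d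

      pair-θ^-shift : (θ^ δ - + 1) ℤ.* θ^ e ≡ w₂ - u₂ mod p
      pair-θ^-shift = begin
        (θ^ δ - + 1) ℤ.* θ^ e      ≡⟨ distrib (θ^ δ) (θ^ e) ⟩
        θ^ δ ℤ.* θ^ e - θ^ e       ≈⟨ -cong-mod (θ^-shift e e') (≡mod-refl {a = θ^ e}) ⟩
        θ^ e' - θ^ e               ≈⟨ -cong-mod (coord₂-sum s') (coord₂-sum s) ⟩
        (w₂ ℤ.+ v₂) - (u₂ ℤ.+ v₂)  ≡⟨ +-cancelʳ-difference w₂ u₂ v₂ ⟩
        w₂ - u₂                    ∎
        where
        open ≡mod-Reasoning p
        distrib : ∀ c a → (c - + 1) ℤ.* a ≡ c ℤ.* a - a
        distrib = solve-∀

      θ^-shift≢1 : ¬ θ^ δ - + 1 ≡ ℤ.0ℤ mod p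
      θ^-shift≢1 θ^δ-1≡0 = u≢w (sym (coords-injective
        (-≡0⇒≡mod (≡mod-trans (≡mod-sym pair-shift-≡) (≡mod-reflexive (cong +_ δ≡0))))
        (-≡0⇒≡mod (begin
          w₂ - u₂                ≈⟨ pair-θ^-shift ⟨
          (θ^ δ - + 1) ℤ.* θ^ e  ≈⟨ *-cong-mod θ^δ-1≡0 (≡mod-refl {a = θ^ e}) ⟩
          ℤ.0ℤ ℤ.* θ^ e          ≡⟨ ℤP.*-zeroˡ (θ^ e) ⟩
          ℤ.0ℤ                   ∎))))
        where
        open ≡mod-Reasoning p
        δ≡0 : δ ≡ 0
        δ≡0 = θ^-injective (shift<N e e') 0<N (-≡0⇒≡mod θ^δ-1≡0)

    pair-quotient : ∀ {v} → SumExponent u v → SumExponent w v → Fin t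
    pair-quotient s s' = shift-quotient (exponent s) (exponent s')

    pair-quotient-injective : ∀ {v v'} (s : SumExponent u v) (s' : SumExponent w v)
                                       (r : SumExponent u v') (r' : SumExponent w v') →
      pair-quotient s s' ≡ pair-quotient r r' → v ≡ v'
    pair-quotient-injective s s' r r' quotients≡ =
      SumExponent-unique s r (*-cancelˡ-mod p-prime (θ^-shift≢1 s s') (begin
        (θ^ δ - + 1) ℤ.* θ^ exponent s   ≈⟨ pair-θ^-shift s s' ⟩
        w₂ - u₂                          ≈⟨ pair-θ^-shift r r' ⟨
        (θ^ δ' - + 1) ℤ.* θ^ exponent r  ≡⟨ cong (λ δ → (θ^ δ - + 1) ℤ.* θ^ exponent r) δ≡δ' ⟨
        (θ^ δ - + 1) ℤ.* θ^ exponent r   ∎))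
      where
      open ≡mod-Reasoning p
      δ  = shift (exponent s) (exponent s')
      δ' = shift (exponent r) (exponent r')
      δ≡δ' : δ ≡ δ'
      δ≡δ' = shift-quotient-injective (exponent s) (exponent s') (exponent r) (exponent r')
               (≡mod-trans (pair-shift-≡ s s') (≡mod-sym (pair-shift-≡ r r'))) quotients≡

  module WithApex (u : Γ) where

    private
      u₁ = coord₁ u
      u₂ = coord₂ u

    module _ {v} (s : SumExponent u v) (s₀ : SumExponent v v) where

      private
        v₁ = coord₁ v
        v₂ = coord₂ v
        e  = exponent s
        e₀ = exponent s₀

      apex-shift : ℕ
      apex-shift = shift (e + e) e₀

      apex-quotient : Fin t
      apex-quotient = shift-quotient (e + e) e₀

      apex-shift-≡ : + apex-shift ≡ - (u₁ ℤ.+ u₁) mod d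
      apex-shift-≡ = begin
        + apex-shift                                ≈⟨ ≡mod-weaken d∣N (shift-≡mod (e + e) e₀) ⟩
        + e₀ - (+ e ℤ.+ + e)                        ≈⟨ -cong-mod (coord₁-sum s₀) (+-cong-mod (coord₁-sum s) (coord₁-sum s)) ⟩
        (v₁ ℤ.+ v₁) - ((u₁ ℤ.+ v₁) ℤ.+ (u₁ ℤ.+ v₁))  ≡⟨ doubled-sum-difference u₁ v₁ ⟩
        - (u₁ ℤ.+ u₁)                               ∎
        where open ≡mod-Reasoning d

      apex-quadratic : quadratic (θ^ apex-shift) (- + 2) (θ^ e) ≡ - (u₂ ℤ.+ u₂) mod p
      apex-quadratic = begin
        quadratic c (- + 2) (θ^ e)                   ≡⟨ regroup c (θ^ e) ⟩
        c ℤ.* (θ^ e ℤ.* θ^ e) - (θ^ e ℤ.+ θ^ e)      ≡⟨ cong (λ y → c ℤ.* y - (θ^ e ℤ.+ θ^ e)) (θ^-+ e e) ⟨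
        c ℤ.* θ^ (e + e) - (θ^ e ℤ.+ θ^ e)           ≈⟨ -cong-mod (≡mod-trans (θ^-shift (e + e) e₀) (coord₂-sum s₀))
                                                                  (+-cong-mod (coord₂-sum s) (coord₂-sum s)) ⟩
        (v₂ ℤ.+ v₂) - ((u₂ ℤ.+ v₂) ℤ.+ (u₂ ℤ.+ v₂))  ≡⟨ doubled-sum-difference u₂ v₂ ⟩
        - (u₂ ℤ.+ u₂)                                ∎
        where
        open ≡mod-Reasoning p
        c = θ^ apex-shift
        regroup : ∀ c x → c ℤ.* x ℤ.* x ℤ.+ - + 2 ℤ.* x ≡ c ℤ.* (x ℤ.* x) - (x ℤ.+ x)
        regroup = solve-∀

    private
      apex-quadratic-at : ∀ {v v'} (s : SumExponent u v) (s₀ : SumExponent v v)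
                                   (r : SumExponent u v') (r₀ : SumExponent v' v') →
        apex-quotient s s₀ ≡ apex-quotient r r₀ →
        quadratic (θ^ apex-shift r r₀) (- + 2) (θ^ exponent s) ≡ - (u₂ ℤ.+ u₂) mod p
      apex-quadratic-at s s₀ r r₀ quotients≡ =
        subst (λ δ → quadratic (θ^ δ) (- + 2) (θ^ exponent s) ≡ - (u₂ ℤ.+ u₂) mod p)
              (shift-quotient-injective (exponent s + exponent s) (exponent s₀) (exponent r + exponent r) (exponent r₀)
                (≡mod-trans (apex-shift-≡ s s₀) (≡mod-sym (apex-shift-≡ r r₀))) quotients≡)
              (apex-quadratic s s₀)

    apex-quotient-≤2-to-1 : ∀ {v₁ v₂ v₃} (s₁ : SumExponent u v₁) (s₁₁ : SumExponent v₁ v₁)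
                                         (s₂ : SumExponent u v₂) (s₂₂ : SumExponent v₂ v₂)
                                         (s₃ : SumExponent u v₃) (s₃₃ : SumExponent v₃ v₃) →
      apex-quotient s₁ s₁₁ ≡ apex-quotient s₂ s₂₂ → apex-quotient s₂ s₂₂ ≡ apex-quotient s₃ s₃₃ →
      v₁ ≢ v₂ → v₂ ≢ v₃ → v₁ ≡ v₃
    apex-quotient-≤2-to-1 s₁ s₁₁ s₂ s₂₂ s₃ s₃₃ q₁≡q₂ q₂≡q₃ v₁≢v₂ v₂≢v₃ =
      SumExponent-unique s₁ s₃ (quadratic-≤2-to-1 p-prime {b = - + 2} (θ^-nonzero (apex-shift s₂ s₂₂))
        (≡mod-trans (apex-quadratic-at s₁ s₁₁ s₂ s₂₂ q₁≡q₂) (≡mod-sym (apex-quadratic s₂ s₂₂)))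
        (≡mod-trans (apex-quadratic s₂ s₂₂) (≡mod-sym (apex-quadratic-at s₃ s₃₃ s₂ s₂₂ (sym q₂≡q₃))))
        (v₁≢v₂ ∘ SumExponent-unique s₁ s₂)
        (v₂≢v₃ ∘ SumExponent-unique s₂ s₃))

  private
    2t+1≡1+[t+t] : 2 * t + 1 ≡ suc (t + t)
    2t+1≡1+[t+t] = trans (ℕP.+-comm (2 * t) 1) (cong (λ n → suc (t + n)) (ℕP.+-identityʳ t))

    t+t<2t+1 : t + t < 2 * t + 1
    t+t<2t+1 = subst (t + t <_) (sym 2t+1≡1+[t+t]) (ℕP.n<1+n (t + t))

    1+t<2t+1 : suc t < 2 * t + 1
    1+t<2t+1 = subst (suc t <_) (sym 2t+1≡1+[t+t]) (s≤s (ℕP.m<m+n t (>-nonZero⁻¹ t)))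

  edge-exponent : ∀ {u v} → Adj u v → SumExponent u v
  edge-exponent = ∈S⇒SumExponent ∘ proj₂

  apex-exponent : ∀ {v} → Adj* nothing (just v) → SumExponent v v
  apex-exponent {v} = ∈S⇒SumExponent ∘ degree≡p∸2⇒self-sum∈S v

  module _ {R : Fin (2 * t + 1) → Γ*} (R-injective : Injective _≡_ _≡_ R) where

    private
      module _ {u w : Γ} (u≢w : u ≢ w) where
        open TwoVertices u≢w

        pair-label : ∀ m → Adj* (just u) m → Adj* (just w) m → Fin (suc t)
        pair-label nothing  _   _   = Fin.zero
        pair-label (just v) u∼v w∼v = Fin.suc (pair-quotient (edge-exponent u∼v) (edge-exponent w∼v))

        pair-label-injective : ∀ {m m'} a b a' b' → pair-label m a b ≡ pair-label m' a' b' → m ≡ m'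
        pair-label-injective {nothing} {nothing} _ _ _ _ _ = refl
        pair-label-injective {just v} {just v'} u∼v w∼v u∼v' w∼v' labels≡ =
          cong just (pair-quotient-injective (edge-exponent u∼v) (edge-exponent w∼v)
                                             (edge-exponent u∼v') (edge-exponent w∼v') (FinP.suc-injective labels≡))

        two-vertices-of-Γ : (∀ j → Adj* (just u) (R j)) → (∀ j → Adj* (just w) (R j)) → ⊥
        two-vertices-of-Γ u∼R w∼R = ℕP.<⇒≱ 1+t<2t+1
          (FinP.injective⇒≤ {f = λ j → pair-label (R j) (u∼R j) (w∼R j)} (R-injective ∘ pair-label-injective _ _ _ _))

      module _ (u : Γ) where
        open WithApex u

        apex-label : ∀ m → Adj* nothing m → Adj* (just u) m → Fin t
        apex-label (just v) apex∼v u∼v = apex-quotient (edge-exponent u∼v) (apex-exponent apex∼v)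

        apex-label-≤2-to-1 : ∀ {m₁ m₂ m₃} a₁ b₁ a₂ b₂ a₃ b₃ →
          apex-label m₁ a₁ b₁ ≡ apex-label m₂ a₂ b₂ → apex-label m₂ a₂ b₂ ≡ apex-label m₃ a₃ b₃ →
          m₁ ≢ m₂ → m₂ ≢ m₃ → m₁ ≡ m₃
        apex-label-≤2-to-1 {just _} {just _} {just _} a₁ b₁ a₂ b₂ a₃ b₃ l₁≡l₂ l₂≡l₃ m₁≢m₂ m₂≢m₃ =
          cong just (apex-quotient-≤2-to-1
            (edge-exponent b₁) (apex-exponent a₁) (edge-exponent b₂) (apex-exponent a₂) (edge-exponent b₃) (apex-exponent a₃)
            l₁≡l₂ l₂≡l₃ (m₁≢m₂ ∘ cong just) (m₂≢m₃ ∘ cong just))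

        vertex-and-apex : (∀ j → Adj* nothing (R j)) → (∀ j → Adj* (just u) (R j)) → ⊥
        vertex-and-apex apex∼R u∼R
          with i , j , k , i<j , j<k , lᵢ≡lⱼ , lⱼ≡lₖ ← pigeonhole₃ (λ j → apex-label (R j) (apex∼R j) (u∼R j)) t+t<2t+1
          = FinP.<⇒≢ (ℕP.<-trans i<j j<k) (R-injective (apex-label-≤2-to-1 _ _ _ _ _ _ lᵢ≡lⱼ lⱼ≡lₖ
              (FinP.<⇒≢ i<j ∘ R-injective) (FinP.<⇒≢ j<k ∘ R-injective)))

    not-both-adjacent-to-all : ∀ x y → x ≢ y → (∀ j → Adj* x (R j)) → (∀ j → Adj* y (R j)) → ⊥
    not-both-adjacent-to-all (just u) (just w) u≢w = two-vertices-of-Γ (u≢w ∘ cong just)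
    not-both-adjacent-to-all nothing  (just u) _   = vertex-and-apex u
    not-both-adjacent-to-all (just u) nothing  _   = flip (vertex-and-apex u)
    not-both-adjacent-to-all nothing  nothing  x≢y = contradiction refl x≢y

  no-K₂,₂ₜ₊₁ : ¬ ContainsK2 Adj* (2 * t + 1)
  no-K₂,₂ₜ₊₁ (f , f-injective , f-adjacent) =
    not-both-adjacent-to-all (inj₂-injective ∘ f-injective) (f (inj₁ Fin.zero)) (f (inj₁ (Fin.suc Fin.zero)))
      (λ f₀≡f₁ → case f-injective f₀≡f₁ of λ ()) (f-adjacent Fin.zero) (f-adjacent (Fin.suc Fin.zero))

lemma4p3 : (p : ℕ) (pr : Prime p) → p ≢ 2 → (θ : ℕ) → θ < p →
    IsGenerator p {{prime⇒nonZero pr}} θ →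
    (t : ℕ) (t≥1 : 1 ≤ t) → t ∣ p ∸ 1 →
    ¬ ContainsK2 (HGraph.Adj* p {{prime⇒nonZero pr}} θ t {{>-nonZero t≥1}}) (2 * t + 1)
lemma4p3 0 0-prime = contradiction 0-prime ¬prime[0]
lemma4p3 1 1-prime = contradiction 1-prime ¬prime[1]
lemma4p3 2 _ p≢2 = contradiction refl p≢2
lemma4p3 (suc (suc (suc _))) p-prime _ θ _ θ-generates t t≥1 t∣N =
  Construction.no-K₂,₂ₜ₊₁ p-prime (s≤s (s≤s z≤n)) θ-generates {{>-nonZero t≥1}} t∣N
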